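{- Let $r\geq 2$. There is a split short exact sequence of $\bar{\mathbb{F}}_2[\mathrm{GL}_2(\mathbb{F}_2)]$-modules $$0\to V_1\to V_r/V_r^{(1)}\to V_0\to 0,$$ where the injection is given by $X\mapsto\overline{X^r}$, $Y\mapsto\overline{Y^r}$, and the surjection is given by $\sum_{0\leq j\leq r}c_j\overline{X^{r-j}Y^j}\mapsto\sum_{1\leq j\leq r-1}c_j\in\bar{\mathbb{F}}_2$.
   Context: For $r\geq 0$, $V_r=\mathrm{Sym}^r\bar{\mathbb{F}}_2^2$ is the space of homogeneous polynomials of degree $r$ in $X,Y$ over $\bar{\mathbb{F}}_2$, with $\mathrm{GL}_2(\mathbb{F}_2)$ acting by $\begin{pmatrix}a&b\\c&d\end{pmatrix}\cdot f(X,Y)=f(aX+cY,bX+dY)$. Let $\theta=X^2Y-XY^2$; $V_r^{(1)}:=\theta V_{r-3}$ if $r\geq 3$ and $V_r^{(1)}:=0$ if $r<3$. Bars denote images in $V_r/V_r^{(1)}$. -}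

module Defs where

open import Level using (Level; _⊔_)
open import Algebra.Bundles using (CommutativeRing)
open import Data.Nat using (ℕ; zero; suc; _∸_; _≤_; _<_; _≟_)
open import Data.Nat.Properties using (m∸n+n≡m)
open import Data.Fin using (Fin; toℕ; cast)
import Data.Fin as Fin
open import Data.Fin.Properties using (toℕ≤pred[n])
open import Data.Bool using (Bool; true; false; if_then_else_; _∧_; _xor_)
open import Data.List using (List; []; _∷_; _++_; length; map; [_])
open import Data.List.Relation.Unary.Any using (Any)
open import Data.Product using (Σ; ∃; _×_; _,_)
open import Relation.Nullary using (¬_; yes; no)
open import Relation.Binary.PropositionalEquality using (_≡_) renaming (cong to ≡-cong; sym to ≡-sym)
import Data.Nat as ℕ

-- GL₂(F₂): matrices (a b; c d) over F₂ = Bool with determinant 1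
-- (over F₂, invertible ⇔ det = 1).

record GL2F2 : Set where
  constructor mat
  field
    a b c d : Bool
    det≡1 : ((a ∧ d) xor (b ∧ c)) ≡ true

module Over {c ℓ : Level} (R : CommutativeRing c ℓ) where
  open CommutativeRing R

  ⟦_⟧ : Bool → Carrier
  ⟦ true ⟧  = 1#
  ⟦ false ⟧ = 0#

  Σᶠ : (n : ℕ) → (Fin n → Carrier) → Carrier
  Σᶠ zero    f = 0#
  Σᶠ (suc n) f = f Fin.zero + Σᶠ n (λ i → f (Fin.suc i))

  -- V_r = Sym^r: homogeneous polynomials of degree r in X, Y;
  -- f j is the coefficient of X^(r-j) Y^j.
  V : ℕ → Set c
  V r = Fin (suc r) → Carrier

  _≋_ : ∀ {r} → V r → V r → Set ℓ
  f ≋ g = ∀ k → f k ≈ g k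

  _⊕_ : ∀ {r} → V r → V r → V r
  (f ⊕ g) k = f k + g k

  _⊖_ : ∀ {r} → V r → V r → V r
  (f ⊖ g) k = f k + (- g k)

  _⊙_ : ∀ {r} → Carrier → V r → V r
  (x ⊙ f) k = x * f k

  𝟘 : ∀ {r} → V r
  𝟘 k = 0#

  mulTerm : ℕ → ℕ → ℕ → Carrier → Carrier → Carrier
  mulTerm i j k x y with i ℕ.+ j ≟ k
  ... | yes _ = x * y
  ... | no _  = 0#

  mul : ∀ {m n} → V m → V n → V (m ℕ.+ n)
  mul {m} {n} f g k =
    Σᶠ (suc m) (λ i → Σᶠ (suc n) (λ j → mulTerm (toℕ i) (toℕ j) (toℕ k) (f i) (g j)))

  lin : Carrier → Carrier → V 1
  lin α β Fin.zero = α
  lin α β (Fin.suc _) = β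

  pow : V 1 → (n : ℕ) → V n
  pow l zero    _ = 1#
  pow l (suc n)   = mul l (pow l n)

  castV : ∀ {m n} → m ≡ n → V m → V n
  castV {m} {n} eq f k = f (cast (≡-cong suc (≡-sym eq)) k)

  term : (r : ℕ) → (j : Fin (suc r)) → Carrier → Carrier → Carrier → Carrier → V r
  term r j a' b' c' d' =
    castV (m∸n+n≡m (toℕ≤pred[n] j))
          (mul (pow (lin a' c') (r ∸ toℕ j)) (pow (lin b' d') (toℕ j)))

  -- the action: (a b; c d) · f(X,Y) = f(aX + cY, bX + dY)
  act : ∀ {r} → GL2F2 → V r → V r
  act {r} (mat a b c d _) f k =
    Σᶠ (suc r) (λ j → f j * term r j ⟦ a ⟧ ⟦ b ⟧ ⟦ c ⟧ ⟦ d ⟧ k)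

  -- θ = X²Y − XY² ∈ V_3
  θ : V 3
  θ Fin.zero = 0#
  θ (Fin.suc Fin.zero) = 1#
  θ (Fin.suc (Fin.suc Fin.zero)) = - 1#
  θ (Fin.suc (Fin.suc (Fin.suc Fin.zero))) = 0#

  InV⁽¹⁾ : (r : ℕ) → V r → Set (c ⊔ ℓ)
  InV⁽¹⁾ (suc (suc (suc n))) f = Σ (V n) (λ h → f ≋ mul θ h)
  InV⁽¹⁾ zero f = Level.Lift c (f ≋ 𝟘)
  InV⁽¹⁾ (suc zero) f = Level.Lift c (f ≋ 𝟘)
  InV⁽¹⁾ (suc (suc zero)) f = Level.Lift c (f ≋ 𝟘)

  ι : (r : ℕ) → V 1 → V r
  ι r u k with toℕ k ≟ 0 | toℕ k ≟ r
  ... | yes _ | _     = u Fin.zero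
  ... | no _  | yes _ = u (Fin.suc Fin.zero)
  ... | no _  | no _  = 0#

  π : (r : ℕ) → V r → V 0
  π r f _ = Σᶠ (suc r) (λ j → inner j)
    where
    inner : Fin (suc r) → Carrier
    inner j with toℕ j ≟ 0 | toℕ j ≟ r
    ... | yes _ | _     = 0#
    ... | no _  | yes _ = 0#
    ... | no _  | no _  = f j

  record SplitSES (r : ℕ) : Set (c ⊔ ℓ) where
    _∼_ : V r → V r → Set (c ⊔ ℓ)
    f ∼ g = InV⁽¹⁾ r (f ⊖ g)
    field
      ι-resp   : ∀ u v → u ≋ v → ι r u ∼ ι r v
      ι-linear : ∀ x u v → ι r ((x ⊙ u) ⊕ v) ∼ ((x ⊙ ι r u) ⊕ ι r v)
      ι-equiv  : ∀ g u → ι r (act g u) ∼ act g (ι r u)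
      π-resp   : ∀ f f' → f ∼ f' → π r f ≋ π r f'
      π-linear : ∀ x f f' → π r ((x ⊙ f) ⊕ f') ≋ ((x ⊙ π r f) ⊕ π r f')
      π-equiv  : ∀ g f → π r (act g f) ≋ act g (π r f)
      ι-injective : ∀ u v → ι r u ∼ ι r v → u ≋ v
      π-surjective : ∀ w → Σ (V r) (λ f → π r f ≋ w)
      im⊆ker : ∀ u → π r (ι r u) ≋ 𝟘
      ker⊆im : ∀ f → π r f ≋ 𝟘 → Σ (V 1) (λ u → ι r u ∼ f)
      s : V 0 → V r
      s-resp   : ∀ w w' → w ≋ w' → s w ∼ s w'
      s-linear : ∀ x w w' → s ((x ⊙ w) ⊕ w') ∼ ((x ⊙ s w) ⊕ s w')
      s-equiv  : ∀ g w → s (act g w) ∼ act g (s w)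
      π∘s≋id   : ∀ w → π r (s w) ≋ w

module _ {c ℓ : Level} (R : CommutativeRing c ℓ) where
  open CommutativeRing R

  evalPoly : List Carrier → Carrier → Carrier
  evalPoly []       x = 0#
  evalPoly (a ∷ as) x = a + x * evalPoly as x

  record IsAlgebraicClosureOfF₂ : Set (c ⊔ ℓ) where
    field
      1≉0      : ¬ (1# ≈ 0#)
      inverses : ∀ x → ¬ (x ≈ 0#) → Σ Carrier (λ y → x * y ≈ 1#)
      char2    : 1# + 1# ≈ 0#
      -- every monic polynomial of degree ≥ 1 has a root
      algClosed : ∀ (as : List Carrier) → 1 ≤ length as →
                  Σ Carrier (λ x → evalPoly (as ++ [ 1# ]) x ≈ 0#)
      -- every element is a root of a nonzero polynomial over F₂
      algebraic : ∀ x → Σ (List Bool) (λ bs →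
                  Any (_≡ true) bs × evalPoly (map (Over.⟦_⟧ R) bs) x ≈ 0#)

-- Evaluating a form at the three points (1,0), (0,1), (1,1) of ℙ¹(F₂) reads off its first
-- coefficient, its last coefficient and its coefficient sum. For r ≥ 2 these three values vanish
-- exactly on V_r⁽¹⁾: θ = XY(X − Y) vanishes on F₂², and conversely a form with vanishing values is
-- θ times the form of its partial coefficient sums. So V_r / V_r⁽¹⁾ embeds in the functions on
-- ℙ¹(F₂), on which g acts by permuting the points, since (g · f)(x) = f(x g). The map ι preserves
-- values, π is (in characteristic 2) the sum of the three values, which is invariant under
-- permutations, and w ↦ w (Xʳ + Xʳ⁻¹Y + Yʳ) is a section whose values are constantly w.
module Submission where

open import Defs
open import Level using (Level; _⊔_; lift)
open import Algebra.Bundles using (CommutativeRing)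
open import Data.Nat using (ℕ; zero; suc; _≤_; _<_; _∸_; z≤n; s≤s)
import Data.Nat as ℕ
import Data.Nat.Properties as ℕ
open import Data.Fin using (Fin; zero; suc; toℕ; fromℕ; inject₁)
open import Data.Fin.Properties using (toℕ-fromℕ; toℕ-inject₁-≢; toℕ≤pred[n]; cast-is-id)
open import Data.Bool using (Bool; true; false; T; _∨_; _xor_)
open import Data.Product using (Σ-syntax; _×_; _,_; proj₁; proj₂)
open import Data.Sum using (inj₁; inj₂)
open import Data.Empty using (⊥-elim)
open import Data.Maybe using (nothing)
open import Function using (_∘_; _$_)
open import Relation.Nullary using (yes; no)
import Relation.Binary.PropositionalEquality as ≡
open ≡ using (_≡_; _≢_)
open import Tactic.RingSolver.Core.AlmostCommutativeRing using (fromCommutativeRing)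
import Tactic.RingSolver.NonReflective as RingSolver

module _ {c ℓ : Level} (R : CommutativeRing c ℓ) where
  open CommutativeRing R hiding (zero)
  open Over R
  open import Algebra.Properties.Ring ring
    using (-1*x≈-x; -0#≈0#; xyx⁻¹≈y; x∙y⁻¹≈ε⇒x≈y; x≈y⇒x∙y⁻¹≈ε)
  open import Algebra.Properties.Semiring.Sum semiring
    using (sum; sum-syntax; sum-cong-≋; sum-cong-≗; sum-replicate-zero; sum-init-last;
           ∑-comm; ∑-distrib-+; *-distribˡ-sum; *-distribʳ-sum)
  open import Algebra.Properties.Semiring.Exp semiring using (_^_; ^-congˡ; ^-homo-*)
  open import Algebra.Properties.CommutativeSemigroup *-commutativeSemigroup using (interchange)
  open import Algebra.Properties.CommutativeSemigroup +-commutativeSemigroup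
    using (x∙yz≈y∙xz; x∙yz≈z∙yx; x∙yz≈x∙zy; x∙yz≈z∙xy; x∙yz≈y∙zx)
  open import Relation.Binary.Reasoning.Setoid setoid
  open RingSolver (fromCommutativeRing R (λ _ → nothing))
    using (solve) renaming (_⊜_ to _:=_; _⊕_ to _:+_; _⊗_ to _:*_)

  Σᶠ≡sum : ∀ n (F : Fin n → Carrier) → Σᶠ n F ≡ sum F
  Σᶠ≡sum zero    F = ≡.refl
  Σᶠ≡sum (suc n) F = ≡.cong (F zero +_) (Σᶠ≡sum n (F ∘ suc))

  sum-zero : ∀ {n} (F : Fin n → Carrier) → (∀ i → F i ≈ 0#) → sum F ≈ 0#
  sum-zero {n} _ F≈0 = trans (sum-cong-≋ F≈0) (sum-replicate-zero n)

  sum-split-ends : ∀ {n} (F : Fin (suc (suc n)) → Carrier) →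
                   sum F ≈ F zero + (sum (λ j → F (suc (inject₁ j))) + F (fromℕ (suc n)))
  sum-split-ends F = +-congˡ (sum-init-last (F ∘ suc))

  1^n≈1 : ∀ n → 1# ^ n ≈ 1#
  1^n≈1 zero    = refl
  1^n≈1 (suc n) = trans (*-identityˡ _) (1^n≈1 n)

  δ : ℕ → ℕ → Carrier → Carrier
  δ zero    zero    x = x
  δ zero    (suc k) x = 0#
  δ (suc i) zero    x = 0#
  δ (suc i) (suc k) x = δ i k x

  δ-diag : ∀ i x → δ i i x ≡ x
  δ-diag zero    x = ≡.refl
  δ-diag (suc i) x = δ-diag i x

  δ-off : ∀ {i k} x → i ≢ k → δ i k x ≡ 0#
  δ-off {zero}  {zero}  x i≢k = ⊥-elim (i≢k ≡.refl)
  δ-off {zero}  {suc k} x i≢k = ≡.refl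
  δ-off {suc i} {zero}  x i≢k = ≡.refl
  δ-off {suc i} {suc k} x i≢k = δ-off x (i≢k ∘ ≡.cong suc)

  sum-δ : ∀ {N} t → t < N → (x : Carrier) (W : ℕ → Carrier) →
          ∑[ k < N ] (δ t (toℕ k) x * W (toℕ k)) ≈ x * W t
  sum-δ {suc N} zero    _         x W =
    trans (+-congˡ (sum-zero {N} (λ k → 0# * W (suc (toℕ k))) (λ _ → zeroˡ _))) (+-identityʳ _)
  sum-δ {suc N} (suc t) (s≤s t<N) x W =
    trans (+-cong (zeroˡ _) (sum-δ t t<N x (W ∘ suc))) (+-identityˡ _)

  extend : ∀ {N} → (Fin N → Carrier) → ℕ → Carrier
  extend {zero}  F _       = 0#
  extend {suc N} F zero    = F zero
  extend {suc N} F (suc t) = extend (F ∘ suc) t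

  extend-toℕ : ∀ {N} (F : Fin N → Carrier) i → extend F (toℕ i) ≡ F i
  extend-toℕ F zero    = ≡.refl
  extend-toℕ F (suc i) = extend-toℕ (F ∘ suc) i

  extend-beyond : ∀ {N} (F : Fin N → Carrier) {t} → N ≤ t → extend F t ≡ 0#
  extend-beyond {zero}  F _         = ≡.refl
  extend-beyond {suc N} F (s≤s N≤t) = extend-beyond (F ∘ suc) N≤t

  extend-tabulate : ∀ {N} (F : ℕ → Carrier) {t} → t < N → extend {N} (F ∘ toℕ) t ≡ F t
  extend-tabulate {suc N} F {zero}  _         = ≡.refl
  extend-tabulate {suc N} F {suc t} (s≤s t<N) = extend-tabulate (F ∘ suc) t<N

  shift : ℕ → (ℕ → Carrier) → ℕ → Carrier
  shift zero    H t       = H t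
  shift (suc s) H zero    = 0#
  shift (suc s) H (suc t) = shift s H t

  shift-cong : ∀ {H H′ : ℕ → Carrier} → (∀ t → H t ≈ H′ t) → ∀ s t → shift s H t ≈ shift s H′ t
  shift-cong H≈H′ zero    t       = H≈H′ t
  shift-cong H≈H′ (suc s) zero    = refl
  shift-cong H≈H′ (suc s) (suc t) = shift-cong H≈H′ s t

  sum-δ-shift : ∀ {N} s t x (G : Fin N → Carrier) →
                ∑[ j < N ] δ (s ℕ.+ toℕ j) t (x * G j) ≈ x * shift s (extend G) t
  sum-δ-shift {zero}  zero    t       x G = sym (zeroʳ x)
  sum-δ-shift {suc N} zero    zero    x G =
    trans (+-congˡ (sum-zero {N} (λ _ → 0#) (λ _ → refl))) (+-identityʳ _)
  sum-δ-shift {suc N} zero    (suc t) x G = trans (+-identityˡ _) (sum-δ-shift zero t x (G ∘ suc))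
  sum-δ-shift {N}     (suc s) zero    x G = trans (sum-zero {N} (λ _ → 0#) (λ _ → refl)) (sym (zeroʳ x))
  sum-δ-shift         (suc s) (suc t) x G = sum-δ-shift s t x G

  mulTerm≡δ : ∀ i j k x y → mulTerm i j k x y ≡ δ (i ℕ.+ j) k (x * y)
  mulTerm≡δ i j k x y with i ℕ.+ j ℕ.≟ k
  ... | yes ≡.refl = ≡.sym (δ-diag (i ℕ.+ j) (x * y))
  ... | no i+j≢k   = ≡.sym (δ-off (x * y) i+j≢k)

  mul-δ : ∀ {m n} (f : V m) (g : V n) k →
          mul f g k ≡ ∑[ i < suc m ] ∑[ j < suc n ] δ (toℕ i ℕ.+ toℕ j) (toℕ k) (f i * g j)
  mul-δ {m} {n} f g k =
    ≡.trans (Σᶠ≡sum (suc m) (λ i → Σᶠ (suc n) (summand i))) (sum-cong-≗ λ i →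
    ≡.trans (Σᶠ≡sum (suc n) (summand i)) (sum-cong-≗ λ j →
    mulTerm≡δ (toℕ i) (toℕ j) (toℕ k) (f i) (g j)))
    where
    summand : Fin (suc m) → Fin (suc n) → Carrier
    summand i j = mulTerm (toℕ i) (toℕ j) (toℕ k) (f i) (g j)

  mul-coeff : ∀ {m n} (f : V m) (g : V n) k →
              mul f g k ≈ ∑[ i < suc m ] (f i * shift (toℕ i) (extend g) (toℕ k))
  mul-coeff f g k =
    trans (reflexive (mul-δ f g k)) (sum-cong-≋ λ i → sum-δ-shift (toℕ i) (toℕ k) (f i) g)

  θ-dot : ∀ (a : Fin 4 → Carrier) → ∑[ i < 4 ] (θ i * a i) ≈ a (suc zero) - a (suc (suc zero))
  θ-dot a = begin
    0# * a₀ + (1# * a₁ + (- 1# * a₂ + (0# * a₃ + 0#)))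
      ≈⟨ +-cong (zeroˡ a₀) (+-cong (*-identityˡ a₁) (+-cong (-1*x≈-x a₂) (+-identityʳ _))) ⟩
    0# + (a₁ + (- a₂ + 0# * a₃))
      ≈⟨ trans (+-identityˡ _) (+-congˡ (trans (+-congˡ (zeroˡ a₃)) (+-identityʳ _))) ⟩
    a₁ - a₂ ∎
    where
    a₀ a₁ a₂ a₃ : Carrier
    a₀ = a zero
    a₁ = a (suc zero)
    a₂ = a (suc (suc zero))
    a₃ = a (suc (suc (suc zero)))

  mul-θ : ∀ {n} (g : V n) k →
          mul θ g k ≈ shift 1 (extend g) (toℕ k) - shift 2 (extend g) (toℕ k)
  mul-θ g k = trans (mul-coeff θ g k) (θ-dot λ i → shift (toℕ i) (extend g) (toℕ k))

  partialSum : ℕ → (ℕ → Carrier) → Carrier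
  partialSum zero    H = 0#
  partialSum (suc t) H = H 0 + partialSum t (H ∘ suc)

  partialSum-snoc : ∀ t H → partialSum (suc t) H ≈ partialSum t H + H t
  partialSum-snoc zero    H = trans (+-identityʳ _) (sym (+-identityˡ _))
  partialSum-snoc (suc t) H =
    trans (+-congˡ (partialSum-snoc t (H ∘ suc))) (sym (+-assoc _ _ _))

  partialSum-extend : ∀ {N} (F : Fin N → Carrier) t → N ≤ t → partialSum t (extend F) ≈ sum F
  partialSum-extend {zero}  F t       _         = partialSum-zero t
    where
    partialSum-zero : ∀ t → partialSum t (λ _ → 0#) ≈ 0#
    partialSum-zero zero    = refl
    partialSum-zero (suc t) = trans (+-identityˡ _) (partialSum-zero t)
  partialSum-extend {suc N} F (suc t) (s≤s N≤t) = +-congˡ (partialSum-extend (F ∘ suc) t N≤t)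

  -- h′ is the sequence of partial sums h₁ + ⋯ + h_{j+1}: the coefficients of θ h′ are the
  -- differences h′_{k-1} − h′_{k-2}, and the three hypotheses make the partial sums stop at 0.
  θ-divides : ∀ n (h : V (3 ℕ.+ n)) → h zero ≈ 0# → h (fromℕ (3 ℕ.+ n)) ≈ 0# → sum h ≈ 0# →
              Σ[ h′ ∈ V n ] h ≋ mul θ h′
  θ-divides n h h₀≈0 hₗ≈0 ∑h≈0 = h′ , h≋θh′
    where
    H : ℕ → Carrier
    H = extend h

    P : ℕ → Carrier
    P t = partialSum (suc t) (H ∘ suc)

    h′ : V n
    h′ j = P (toℕ j)

    H-vanishes : ∀ t → 3 ℕ.+ n ≤ t → H t ≈ 0#
    H-vanishes t 3+n≤t with ℕ.m≤n⇒m<n∨m≡n 3+n≤t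
    ... | inj₁ 3+n<t  = reflexive (extend-beyond h 3+n<t)
    ... | inj₂ ≡.refl = trans (reflexive (≡.trans (≡.cong H (≡.sym (toℕ-fromℕ (3 ℕ.+ n))))
                                                   (extend-toℕ h (fromℕ (3 ℕ.+ n)))))
                              hₗ≈0

    P-vanishes : ∀ t → n < t → P t ≈ 0#
    P-vanishes t n<t = begin
      P t                     ≈⟨ +-identityʳ _ ⟨
      P t + 0#                ≈⟨ +-congˡ (H-vanishes (suc (suc t)) (s≤s (s≤s n<t))) ⟨
      P t + H (suc (suc t))   ≈⟨ partialSum-snoc (suc t) (H ∘ suc) ⟨
      P (suc t)               ≈⟨ partialSum-extend (h ∘ suc) (suc (suc t)) (s≤s (s≤s n<t)) ⟩
      sum (h ∘ suc)           ≈⟨ +-identityˡ _ ⟨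
      0# + sum (h ∘ suc)      ≈⟨ +-congʳ h₀≈0 ⟨
      sum h                   ≈⟨ ∑h≈0 ⟩
      0#                      ∎

    extend-h′ : ∀ t → extend h′ t ≈ P t
    extend-h′ t with t ℕ.<? suc n
    ... | yes t<1+n = reflexive (extend-tabulate P t<1+n)
    ... | no  t≮1+n = trans (reflexive (extend-beyond h′ (ℕ.≮⇒≥ t≮1+n)))
                            (sym (P-vanishes t (ℕ.≮⇒≥ t≮1+n)))

    H≈ΔP : ∀ t → H t ≈ shift 1 P t - shift 2 P t
    H≈ΔP zero          = trans h₀≈0 (sym (-‿inverseʳ 0#))
    H≈ΔP (suc zero)    = sym (trans (+-congˡ -0#≈0#) (trans (+-identityʳ _) (+-identityʳ _)))
    H≈ΔP (suc (suc t)) = sym (begin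
      P (suc t) - P t                 ≈⟨ +-congʳ (partialSum-snoc (suc t) (H ∘ suc)) ⟩
      (P t + H (suc (suc t))) - P t   ≈⟨ xyx⁻¹≈y _ _ ⟩
      H (suc (suc t))                 ∎)

    h≋θh′ : h ≋ mul θ h′
    h≋θh′ k = begin
      h k                                     ≡⟨ extend-toℕ h k ⟨
      H (toℕ k)                               ≈⟨ H≈ΔP (toℕ k) ⟩
      shift 1 P (toℕ k) - shift 2 P (toℕ k)   ≈⟨ +-cong (shift-cong extend-h′ 1 (toℕ k))
                                                        (-‿cong (shift-cong extend-h′ 2 (toℕ k))) ⟨
      shift 1 (extend h′) (toℕ k) - shift 2 (extend h′) (toℕ k)
                                              ≈⟨ mul-θ h′ k ⟨
      mul θ h′ k                              ∎

  -- Evaluation of forms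

  monomial : ℕ → ℕ → Carrier → Carrier → Carrier
  monomial r t p q = p ^ (r ∸ t) * q ^ t

  ev : ∀ {r} → V r → Carrier → Carrier → Carrier
  ev {r} f p q = ∑[ j < suc r ] (f j * monomial r (toℕ j) p q)

  ev-cong : ∀ {r} {f g : V r} → f ≋ g → ∀ p q → ev f p q ≈ ev g p q
  ev-cong {r} f≋g p q = sum-cong-≋ λ j → *-cong (f≋g j) (refl {x = monomial r (toℕ j) p q})

  ev-cong₂ : ∀ {r} (f : V r) {p p′ q q′} → p ≈ p′ → q ≈ q′ → ev f p q ≈ ev f p′ q′
  ev-cong₂ {r} f p≈p′ q≈q′ = sum-cong-≋ λ j →
    *-cong (refl {x = f j}) (*-cong (^-congˡ (r ∸ toℕ j) p≈p′) (^-congˡ (toℕ j) q≈q′))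

  ev-𝟘 : ∀ {r} p q → ev (𝟘 {r}) p q ≈ 0#
  ev-𝟘 {r} p q = sum-zero {suc r} (λ j → 0# * monomial r (toℕ j) p q) λ j → zeroˡ _

  ev-linear : ∀ {r} x (f g : V r) p q → ev ((x ⊙ f) ⊕ g) p q ≈ x * ev f p q + ev g p q
  ev-linear {r} x f g p q = begin
    ∑[ j < suc r ] ((x * f j + g j) * M j)
      ≈⟨ sum-cong-≋ (λ j → trans (distribʳ (M j) (x * f j) (g j)) (+-congʳ (*-assoc x (f j) (M j)))) ⟩
    ∑[ j < suc r ] (x * (f j * M j) + g j * M j)
      ≈⟨ ∑-distrib-+ (λ j → x * (f j * M j)) (λ j → g j * M j) ⟩
    ∑[ j < suc r ] (x * (f j * M j)) + ev g p q
      ≈⟨ +-congʳ (*-distribˡ-sum x (λ j → f j * M j)) ⟨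
    x * ev f p q + ev g p q ∎
    where
    M : Fin (suc r) → Carrier
    M j = monomial r (toℕ j) p q

  ev-⊖ : ∀ {r} (f g : V r) p q → ev (f ⊖ g) p q ≈ ev f p q - ev g p q
  ev-⊖ f g p q = begin
    ev (f ⊖ g) p q
      ≈⟨ ev-cong (λ k → trans (+-comm (- 1# * g k) (f k)) (+-congˡ (-1*x≈-x (g k)))) p q ⟨
    ev (((- 1#) ⊙ g) ⊕ f) p q   ≈⟨ ev-linear (- 1#) g f p q ⟩
    - 1# * ev g p q + ev f p q  ≈⟨ trans (+-comm _ _) (+-congˡ (-1*x≈-x _)) ⟩
    ev f p q - ev g p q         ∎

  monomial-+ : ∀ {m n i j} → i ≤ m → j ≤ n → ∀ p q →
               monomial (m ℕ.+ n) (i ℕ.+ j) p q ≈ monomial m i p q * monomial n j p q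
  monomial-+ {m} {n} {i} {j} i≤m j≤n p q = begin
    p ^ (m ℕ.+ n ∸ (i ℕ.+ j)) * q ^ (i ℕ.+ j)     ≡⟨ ≡.cong (λ e → p ^ e * q ^ (i ℕ.+ j)) exponent ⟩
    p ^ ((m ∸ i) ℕ.+ (n ∸ j)) * q ^ (i ℕ.+ j)     ≈⟨ *-cong (^-homo-* p (m ∸ i) (n ∸ j)) (^-homo-* q i j) ⟩
    (p ^ (m ∸ i) * p ^ (n ∸ j)) * (q ^ i * q ^ j) ≈⟨ interchange _ _ _ _ ⟩
    monomial m i p q * monomial n j p q           ∎
    where
    exponent : m ℕ.+ n ∸ (i ℕ.+ j) ≡ (m ∸ i) ℕ.+ (n ∸ j)
    exponent = ≡.trans (≡.sym (ℕ.∸-+-assoc (m ℕ.+ n) i j))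
               (≡.trans (≡.cong (_∸ j) (ℕ.+-∸-comm n i≤m)) (ℕ.+-∸-assoc (m ∸ i) j≤n))

  ev-mul : ∀ {m n} (f : V m) (g : V n) p q → ev (mul f g) p q ≈ ev f p q * ev g p q
  ev-mul {m} {n} f g p q = begin
    ∑[ k < suc (m ℕ.+ n) ] (mul f g k * M (m ℕ.+ n) (toℕ k))
      ≈⟨ sum-cong-≋ (λ k → trans (*-cong (reflexive (mul-δ f g k)) refl) (distribute k)) ⟩
    ∑[ k < suc (m ℕ.+ n) ] ∑[ i < suc m ] ∑[ j < suc n ] D i j k
      ≈⟨ ∑-comm (λ k i → ∑[ j < suc n ] D i j k) ⟩
    ∑[ i < suc m ] ∑[ k < suc (m ℕ.+ n) ] ∑[ j < suc n ] D i j k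
      ≈⟨ sum-cong-≋ (λ i → ∑-comm (λ k j → D i j k)) ⟩
    ∑[ i < suc m ] ∑[ j < suc n ] ∑[ k < suc (m ℕ.+ n) ] D i j k
      ≈⟨ sum-cong-≋ (λ i → sum-cong-≋ λ j →
           sum-δ (toℕ i ℕ.+ toℕ j) (bound i j) (f i * g j) (M (m ℕ.+ n))) ⟩
    ∑[ i < suc m ] ∑[ j < suc n ] ((f i * g j) * M (m ℕ.+ n) (toℕ i ℕ.+ toℕ j))
      ≈⟨ sum-cong-≋ (λ i → sum-cong-≋ λ j → split i j) ⟩
    ∑[ i < suc m ] ∑[ j < suc n ] ((f i * M m (toℕ i)) * (g j * M n (toℕ j)))
      ≈⟨ sum-cong-≋ (λ i → *-distribˡ-sum (f i * M m (toℕ i)) (λ j → g j * M n (toℕ j))) ⟨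
    ∑[ i < suc m ] ((f i * M m (toℕ i)) * ev g p q)
      ≈⟨ *-distribʳ-sum (ev g p q) (λ i → f i * M m (toℕ i)) ⟨
    ev f p q * ev g p q ∎
    where
    M : ℕ → ℕ → Carrier
    M r t = monomial r t p q

    Δ : Fin (suc (m ℕ.+ n)) → Fin (suc m) → Fin (suc n) → Carrier
    Δ k i j = δ (toℕ i ℕ.+ toℕ j) (toℕ k) (f i * g j)

    D : Fin (suc m) → Fin (suc n) → Fin (suc (m ℕ.+ n)) → Carrier
    D i j k = Δ k i j * M (m ℕ.+ n) (toℕ k)

    distribute : ∀ k → (∑[ i < suc m ] ∑[ j < suc n ] Δ k i j) * M (m ℕ.+ n) (toℕ k)
                       ≈ ∑[ i < suc m ] ∑[ j < suc n ] D i j k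
    distribute k = trans (*-distribʳ-sum (M (m ℕ.+ n) (toℕ k)) (λ i → ∑[ j < suc n ] Δ k i j))
                         (sum-cong-≋ λ i → *-distribʳ-sum (M (m ℕ.+ n) (toℕ k)) (Δ k i))

    bound : ∀ (i : Fin (suc m)) (j : Fin (suc n)) → toℕ i ℕ.+ toℕ j < suc (m ℕ.+ n)
    bound i j = s≤s (ℕ.+-mono-≤ (toℕ≤pred[n] i) (toℕ≤pred[n] j))

    split : ∀ i j → (f i * g j) * M (m ℕ.+ n) (toℕ i ℕ.+ toℕ j)
                    ≈ (f i * M m (toℕ i)) * (g j * M n (toℕ j))
    split i j = trans (*-congˡ (monomial-+ (toℕ≤pred[n] i) (toℕ≤pred[n] j) p q))
                      (interchange (f i) (g j) (M m (toℕ i)) (M n (toℕ j)))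

  ev-lin : ∀ α β p q → ev (lin α β) p q ≈ α * p + β * q
  ev-lin α β p q =
    +-cong (*-congˡ (trans (*-identityʳ _) (*-identityʳ p)))
           (trans (+-identityʳ _) (*-congˡ (trans (*-identityˡ _) (*-identityʳ q))))

  ev-pow : ∀ (l : V 1) n p q → ev (pow l n) p q ≈ ev l p q ^ n
  ev-pow l zero    p q = trans (+-identityʳ _) (trans (*-identityˡ _) (*-identityʳ 1#))
  ev-pow l (suc n) p q = trans (ev-mul l (pow l n) p q) (*-congˡ (ev-pow l n p q))

  ev-castV : ∀ {m n} (m≡n : m ≡ n) (f : V m) p q → ev (castV m≡n f) p q ≈ ev f p q
  ev-castV {m} ≡.refl f p q = sum-cong-≋ λ k →
    *-cong (reflexive (≡.cong f (cast-is-id ≡.refl k))) (refl {x = monomial m (toℕ k) p q})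

  ev-term : ∀ r j a b c d p q →
            ev (term r j a b c d) p q ≈ (a * p + c * q) ^ (r ∸ toℕ j) * (b * p + d * q) ^ toℕ j
  ev-term r j a b c d p q = begin
    ev (term r j a b c d) p q   ≈⟨ ev-castV (ℕ.m∸n+n≡m (toℕ≤pred[n] j)) (mul Pᵃᶜ Pᵇᵈ) p q ⟩
    ev (mul Pᵃᶜ Pᵇᵈ) p q        ≈⟨ ev-mul Pᵃᶜ Pᵇᵈ p q ⟩
    ev Pᵃᶜ p q * ev Pᵇᵈ p q     ≈⟨ *-cong (trans (ev-pow (lin a c) (r ∸ toℕ j) p q)
                                                 (^-congˡ (r ∸ toℕ j) (ev-lin a c p q)))
                                          (trans (ev-pow (lin b d) (toℕ j) p q)
                                                 (^-congˡ (toℕ j) (ev-lin b d p q))) ⟩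
    (a * p + c * q) ^ (r ∸ toℕ j) * (b * p + d * q) ^ toℕ j ∎
    where
    Pᵃᶜ : V (r ∸ toℕ j)
    Pᵃᶜ = pow (lin a c) (r ∸ toℕ j)
    Pᵇᵈ : V (toℕ j)
    Pᵇᵈ = pow (lin b d) (toℕ j)

  ev-act : ∀ {r} a b c d det (f : V r) p q →
           ev (act (mat a b c d det) f) p q ≈ ev f (⟦ a ⟧ * p + ⟦ c ⟧ * q) (⟦ b ⟧ * p + ⟦ d ⟧ * q)
  ev-act {r} a b c d det f p q = begin
    ∑[ k < suc r ] (act (mat a b c d det) f k * M k)
      ≈⟨ sum-cong-≋ (λ k → trans (*-cong (reflexive (Σᶠ≡sum (suc r) (λ j → f j * t j k))) refl)
                                 (*-distribʳ-sum (M k) (λ j → f j * t j k))) ⟩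
    ∑[ k < suc r ] ∑[ j < suc r ] (f j * t j k * M k)
      ≈⟨ ∑-comm (λ k j → f j * t j k * M k) ⟩
    ∑[ j < suc r ] ∑[ k < suc r ] (f j * t j k * M k)
      ≈⟨ sum-cong-≋ (λ j → trans (sum-cong-≋ λ k → *-assoc (f j) (t j k) (M k))
                                 (sym (*-distribˡ-sum (f j) (λ k → t j k * M k)))) ⟩
    ∑[ j < suc r ] (f j * ev (term r j ⟦ a ⟧ ⟦ b ⟧ ⟦ c ⟧ ⟦ d ⟧) p q)
      ≈⟨ sum-cong-≋ (λ j → *-cong (refl {x = f j}) (ev-term r j ⟦ a ⟧ ⟦ b ⟧ ⟦ c ⟧ ⟦ d ⟧ p q)) ⟩
    ev f (⟦ a ⟧ * p + ⟦ c ⟧ * q) (⟦ b ⟧ * p + ⟦ d ⟧ * q) ∎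
    where
    t : Fin (suc r) → Fin (suc r) → Carrier
    t j = term r j ⟦ a ⟧ ⟦ b ⟧ ⟦ c ⟧ ⟦ d ⟧

    M : Fin (suc r) → Carrier
    M k = monomial r (toℕ k) p q

  ev-V₀ : ∀ (w : V 0) p q → ev w p q ≈ w zero
  ev-V₀ w p q = trans (+-identityʳ _) (trans (*-congˡ (*-identityʳ 1#)) (*-identityʳ _))

  ev-[1:0] : ∀ {r} (f : V r) → ev f 1# 0# ≈ f zero
  ev-[1:0] {r} f = trans
    (+-cong (trans (*-congˡ (trans (*-identityʳ _) (1^n≈1 r))) (*-identityʳ _))
            (sum-zero {r} (λ j → f (suc j) * monomial r (suc (toℕ j)) 1# 0#)
                      (λ j → trans (*-congˡ (trans (*-congˡ (zeroˡ _)) (zeroʳ _))) (zeroʳ _))))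
    (+-identityʳ _)

  ev-[0:1] : ∀ {r} (f : V r) → ev f 0# 1# ≈ f (fromℕ r)
  ev-[0:1] {zero}  f = ev-V₀ f 0# 1#
  ev-[0:1] {suc r} f = begin
    f zero * (0# ^ suc r * 1#) + ∑[ j < suc r ] (f (suc j) * (0# ^ (r ∸ toℕ j) * (1# * 1# ^ toℕ j)))
      ≈⟨ +-cong (trans (*-congˡ (trans (*-identityʳ _) (zeroˡ _))) (zeroʳ _))
                (sum-cong-≋ λ j → *-cong (refl {x = f (suc j)})
                                         (*-cong (refl {x = 0# ^ (r ∸ toℕ j)}) (*-identityˡ (1# ^ toℕ j)))) ⟩
    0# + ev (f ∘ suc) 0# 1#   ≈⟨ +-identityˡ _ ⟩
    ev (f ∘ suc) 0# 1#        ≈⟨ ev-[0:1] (f ∘ suc) ⟩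
    f (fromℕ (suc r))         ∎

  ev-[1:1] : ∀ {r} (f : V r) → ev f 1# 1# ≈ sum f
  ev-[1:1] {r} f = sum-cong-≋ λ j →
    trans (*-congˡ (trans (*-cong (1^n≈1 (r ∸ toℕ j)) (1^n≈1 (toℕ j))) (*-identityʳ 1#))) (*-identityʳ (f j))

  ev-θ : ∀ {p q} → p * p ≈ p → q * q ≈ q → ev θ p q ≈ 0#
  ev-θ {p} {q} p²≈p q²≈q = begin
    ev θ p q                                              ≈⟨ θ-dot (λ j → monomial 3 (toℕ j) p q) ⟩
    (p * (p * 1#)) * (q * 1#) - (p * 1#) * (q * (q * 1#)) ≈⟨ +-cong p²q≈pq (-‿cong pq²≈pq) ⟩
    p * q - p * q                                         ≈⟨ -‿inverseʳ (p * q) ⟩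
    0#                                                    ∎
    where
    p²q≈pq : (p * (p * 1#)) * (q * 1#) ≈ p * q
    p²q≈pq = trans (*-cong (*-congˡ (*-identityʳ p)) (*-identityʳ q)) (*-congʳ p²≈p)
    pq²≈pq : (p * 1#) * (q * (q * 1#)) ≈ p * q
    pq²≈pq = trans (*-cong (*-identityʳ p) (*-congˡ (*-identityʳ q))) (*-congˡ q²≈q)

  act-V₀ : ∀ g (w : V 0) → act g w ≋ w
  act-V₀ g@(mat a b c d det) w zero = begin
    act g w zero         ≈⟨ ev-[1:0] (act g w) ⟨
    ev (act g w) 1# 0#   ≈⟨ ev-act a b c d det w 1# 0# ⟩
    ev w p q             ≈⟨ ev-V₀ w p q ⟩
    w zero               ∎
    where
    p q : Carrier
    p = ⟦ a ⟧ * 1# + ⟦ c ⟧ * 0#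
    q = ⟦ b ⟧ * 1# + ⟦ d ⟧ * 0#

  ι-middle : ∀ r (u : V 1) k → toℕ k ≢ 0 → toℕ k ≢ r → ι r u k ≡ 0#
  ι-middle r u k k≢0 k≢r with toℕ k ℕ.≟ 0 | toℕ k ℕ.≟ r
  ... | yes k≡0 | _       = ⊥-elim (k≢0 k≡0)
  ... | no _    | yes k≡r = ⊥-elim (k≢r k≡r)
  ... | no _    | no _    = ≡.refl

  ι-last : ∀ r (u : V 1) → ι (suc r) u (fromℕ (suc r)) ≡ u (suc zero)
  ι-last r u with toℕ (fromℕ (suc r)) ℕ.≟ suc r
  ... | yes _ = ≡.refl
  ... | no ne = ⊥-elim (ne (toℕ-fromℕ (suc r)))

  ι-sum : ∀ r (u : V 1) → sum (ι (suc r) u) ≈ sum u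
  ι-sum r u = begin
    sum (ι (suc r) u)
      ≈⟨ sum-split-ends (ι (suc r) u) ⟩
    u zero + (∑[ j < r ] ι (suc r) u (suc (inject₁ j)) + ι (suc r) u (fromℕ (suc r)))
      ≈⟨ +-congˡ (+-cong (sum-zero {r} (λ j → ι (suc r) u (suc (inject₁ j))) middle)
                         (reflexive (ι-last r u))) ⟩
    u zero + (0# + u (suc zero))
      ≈⟨ +-congˡ (trans (+-identityˡ _) (sym (+-identityʳ _))) ⟩
    sum u ∎
    where
    middle : ∀ j → ι (suc r) u (suc (inject₁ j)) ≈ 0#
    middle j = reflexive (ι-middle (suc r) u (suc (inject₁ j)) (λ ())
                                   (toℕ-inject₁-≢ j ∘ ≡.sym ∘ ℕ.suc-injective))

  -- The summand of π is local to its where-block; unification against the unfolding of π names it.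
  π-as-sum : ∀ {r} (f : V r) w → Σ[ S ∈ (Fin r → Carrier) ] π r f w ≡ 0# + Σᶠ r S
  π-as-sum f w = _ , ≡.refl

  π-summand : ∀ {r} → V r → Fin 1 → Fin r → Carrier
  π-summand f w = proj₁ (π-as-sum f w)

  π-summand-inner : ∀ {r} (f : V r) w j → suc (toℕ j) ≢ r → π-summand f w j ≈ f (suc j)
  π-summand-inner {r} f w j 1+j≢r with suc (toℕ j) ℕ.≟ r
  ... | yes 1+j≡r = ⊥-elim (1+j≢r 1+j≡r)
  ... | no _      = refl

  π-summand-outer : ∀ {r} (f : V r) w j → suc (toℕ j) ≡ r → π-summand f w j ≈ 0#
  π-summand-outer {r} f w j 1+j≡r with suc (toℕ j) ℕ.≟ r
  ... | yes _    = refl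
  ... | no 1+j≢r = ⊥-elim (1+j≢r 1+j≡r)

  π-ends : ∀ {r} (f : V r) w → 1 ≤ r → f zero + (π r f w + f (fromℕ r)) ≈ sum f
  π-ends {suc r} f w _ = begin
    f zero + (π (suc r) f w + fₗ)
      ≡⟨ ≡.cong (λ x → f zero + (x + fₗ))
                (≡.trans (proj₂ (π-as-sum f w)) (≡.cong (0# +_) (Σᶠ≡sum (suc r) S))) ⟩
    f zero + ((0# + sum S) + fₗ)
      ≈⟨ +-congˡ (+-congʳ (trans (+-identityˡ _) (sum-init-last S))) ⟩
    f zero + ((∑[ j < r ] S (inject₁ j) + S (fromℕ r)) + fₗ)
      ≈⟨ +-congˡ (+-congʳ (+-cong (sum-cong-≋ inner)
                                   (π-summand-outer f w (fromℕ r) (≡.cong suc (toℕ-fromℕ r))))) ⟩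
    f zero + ((∑[ j < r ] f (suc (inject₁ j)) + 0#) + fₗ)
      ≈⟨ +-congˡ (+-congʳ (+-identityʳ _)) ⟩
    f zero + (∑[ j < r ] f (suc (inject₁ j)) + fₗ)
      ≈⟨ sum-split-ends f ⟨
    sum f ∎
    where
    fₗ : Carrier
    fₗ = f (fromℕ (suc r))

    S : Fin (suc r) → Carrier
    S = π-summand f w

    inner : ∀ j → S (inject₁ j) ≈ f (suc (inject₁ j))
    inner j = π-summand-inner f w (inject₁ j) (toℕ-inject₁-≢ j ∘ ≡.sym ∘ ℕ.suc-injective)

  -- The three points of ℙ¹(F₂), and V_r / V_r⁽¹⁾

  F₂² : Set
  F₂² = Bool × Bool

  Nonzero : F₂² → Set
  Nonzero (p , q) = T (p ∨ q)

  ℙ¹-elim : ∀ {a} (P : F₂² → Set a) → P (true , false) → P (false , true) → P (true , true) →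
            ∀ x → Nonzero x → P x
  ℙ¹-elim P P₁₀ P₀₁ P₁₁ (true  , false) _ = P₁₀
  ℙ¹-elim P P₁₀ P₀₁ P₁₁ (false , true)  _ = P₀₁
  ℙ¹-elim P P₁₀ P₀₁ P₁₁ (true  , true)  _ = P₁₁

  evB : ∀ {r} → V r → F₂² → Carrier
  evB f (p , q) = ev f ⟦ p ⟧ ⟦ q ⟧

  record _≐_ {m n} (f : V m) (g : V n) : Set ℓ where
    constructor agree
    field
      at : ∀ x → Nonzero x → evB f x ≈ evB g x

  ≐-sym : ∀ {m n} {f : V m} {g : V n} → f ≐ g → g ≐ f
  ≐-sym (agree f≐g) = agree λ x nz → sym (f≐g x nz)

  ≐-trans : ∀ {m n o} {f : V m} {g : V n} {h : V o} → f ≐ g → g ≐ h → f ≐ h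
  ≐-trans (agree f≐g) (agree g≐h) = agree λ x nz → trans (f≐g x nz) (g≐h x nz)

  ≋⇒≐ : ∀ {r} {f g : V r} → f ≋ g → f ≐ g
  ≋⇒≐ f≋g = agree λ { (p , q) _ → ev-cong f≋g ⟦ p ⟧ ⟦ q ⟧ }

  ≐-intro : ∀ {m n} {f : V m} {g : V n} → f zero ≈ g zero → f (fromℕ m) ≈ g (fromℕ n) →
            sum f ≈ sum g → f ≐ g
  ≐-intro {f = f} {g} first last total = agree $ ℙ¹-elim (λ x → evB f x ≈ evB g x)
    (trans (ev-[1:0] f) (trans first (sym (ev-[1:0] g))))
    (trans (ev-[0:1] f) (trans last (sym (ev-[0:1] g))))
    (trans (ev-[1:1] f) (trans total (sym (ev-[1:1] g))))

  ≐⇒≋ : ∀ {u v : V 1} → u ≐ v → u ≋ v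
  ≐⇒≋ {u} {v} (agree u≐v) zero       =
    trans (sym (ev-[1:0] u)) (trans (u≐v (true , false) _) (ev-[1:0] v))
  ≐⇒≋ {u} {v} (agree u≐v) (suc zero) =
    trans (sym (ev-[0:1] u)) (trans (u≐v (false , true) _) (ev-[0:1] v))

  linear-≐ : ∀ {m n} x {f g : V m} {f′ g′ : V n} → f ≐ f′ → g ≐ g′ →
             ((x ⊙ f) ⊕ g) ≐ ((x ⊙ f′) ⊕ g′)
  linear-≐ x {f} {g} {f′} {g′} (agree f≐f′) (agree g≐g′) = agree λ where
    y@(p , q) nz → begin
      evB ((x ⊙ f) ⊕ g) y      ≈⟨ ev-linear x f g ⟦ p ⟧ ⟦ q ⟧ ⟩
      x * evB f y + evB g y    ≈⟨ +-cong (*-congˡ (f≐f′ y nz)) (g≐g′ y nz) ⟩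
      x * evB f′ y + evB g′ y  ≈⟨ ev-linear x f′ g′ ⟦ p ⟧ ⟦ q ⟧ ⟨
      evB ((x ⊙ f′) ⊕ g′) y    ∎

  ι≐ : ∀ r (u : V 1) → ι (suc r) u ≐ u
  ι≐ r u = ≐-intro {f = ι (suc r) u} {g = u} refl (reflexive (ι-last r u)) (ι-sum r u)

  π≋𝟘⇒ι≐ : ∀ {r} (f : V (suc r)) → π (suc r) f ≋ 𝟘 → ι (suc r) (lin (f zero) (f (fromℕ (suc r)))) ≐ f
  π≋𝟘⇒ι≐ {r} f πf≋𝟘 = ≐-trans (ι≐ r u) (≐-intro {f = u} {g = f} refl refl (begin
    f zero + (fₗ + 0#)               ≈⟨ +-congˡ (trans (+-identityʳ _) (sym (+-identityˡ _))) ⟩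
    f zero + (0# + fₗ)               ≈⟨ +-congˡ (+-congʳ (πf≋𝟘 zero)) ⟨
    f zero + (π (suc r) f zero + fₗ) ≈⟨ π-ends f zero (s≤s z≤n) ⟩
    sum f                            ∎))
    where
    fₗ : Carrier
    fₗ = f (fromℕ (suc r))

    u : V 1
    u = lin (f zero) fₗ

  ⟦⟧-idempotent : ∀ b → ⟦ b ⟧ * ⟦ b ⟧ ≈ ⟦ b ⟧
  ⟦⟧-idempotent true  = *-identityˡ 1#
  ⟦⟧-idempotent false = zeroˡ 0#

  InV⁽¹⁾⇒vanishes : ∀ q {h : V (2 ℕ.+ q)} → InV⁽¹⁾ (2 ℕ.+ q) h → ∀ x → evB h x ≈ 0#
  InV⁽¹⁾⇒vanishes zero    (lift h≋𝟘) (p , q) = trans (ev-cong h≋𝟘 ⟦ p ⟧ ⟦ q ⟧) (ev-𝟘 {2} ⟦ p ⟧ ⟦ q ⟧)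
  InV⁽¹⁾⇒vanishes (suc n) {h} (h′ , h≋θh′) (p , q) = begin
    ev h ⟦ p ⟧ ⟦ q ⟧                       ≈⟨ ev-cong h≋θh′ ⟦ p ⟧ ⟦ q ⟧ ⟩
    ev (mul θ h′) ⟦ p ⟧ ⟦ q ⟧              ≈⟨ ev-mul θ h′ ⟦ p ⟧ ⟦ q ⟧ ⟩
    ev θ ⟦ p ⟧ ⟦ q ⟧ * ev h′ ⟦ p ⟧ ⟦ q ⟧   ≈⟨ *-congʳ (ev-θ (⟦⟧-idempotent p) (⟦⟧-idempotent q)) ⟩
    0# * ev h′ ⟦ p ⟧ ⟦ q ⟧                 ≈⟨ zeroˡ _ ⟩
    0#                                     ∎

  InV⁽¹⁾-intro : ∀ q (h : V (2 ℕ.+ q)) → h zero ≈ 0# → h (fromℕ (2 ℕ.+ q)) ≈ 0# → sum h ≈ 0# →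
                 InV⁽¹⁾ (2 ℕ.+ q) h
  InV⁽¹⁾-intro zero    h h₀≈0 h₂≈0 ∑h≈0 = lift λ where
    zero             → h₀≈0
    (suc zero)       → trans (sym (trans (+-cong h₀≈0 (+-congˡ (trans (+-identityʳ _) h₂≈0)))
                                         (trans (+-identityˡ _) (+-identityʳ _))))
                             ∑h≈0
    (suc (suc zero)) → h₂≈0
  InV⁽¹⁾-intro (suc n) = θ-divides n

  vanishes⇒InV⁽¹⁾ : ∀ q {h : V (2 ℕ.+ q)} → (∀ x → Nonzero x → evB h x ≈ 0#) → InV⁽¹⁾ (2 ℕ.+ q) h
  vanishes⇒InV⁽¹⁾ q {h} h≐𝟘 = InV⁽¹⁾-intro q h
    (trans (sym (ev-[1:0] h)) (h≐𝟘 (true , false) _))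
    (trans (sym (ev-[0:1] h)) (h≐𝟘 (false , true) _))
    (trans (sym (ev-[1:1] h)) (h≐𝟘 (true , true) _))

  InV⁽¹⁾-⊖⇒≐ : ∀ q {f g : V (2 ℕ.+ q)} → InV⁽¹⁾ (2 ℕ.+ q) (f ⊖ g) → f ≐ g
  InV⁽¹⁾-⊖⇒≐ q {f} {g} f∼g = agree λ where
    x@(p , q′) _ → x∙y⁻¹≈ε⇒x≈y _ _ (trans (sym (ev-⊖ f g ⟦ p ⟧ ⟦ q′ ⟧)) (InV⁽¹⁾⇒vanishes q f∼g x))

  ≐⇒InV⁽¹⁾-⊖ : ∀ q {f g : V (2 ℕ.+ q)} → f ≐ g → InV⁽¹⁾ (2 ℕ.+ q) (f ⊖ g)
  ≐⇒InV⁽¹⁾-⊖ q {f} {g} (agree f≐g) = vanishes⇒InV⁽¹⁾ q λ where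
    x@(p , q′) nz → trans (ev-⊖ f g ⟦ p ⟧ ⟦ q′ ⟧) (x≈y⇒x∙y⁻¹≈ε (f≐g x nz))

  Σℙ¹ : (F₂² → Carrier) → Carrier
  Σℙ¹ F = F (true , false) + (F (false , true) + F (true , true))

  Σℙ¹-cong : ∀ {F G : F₂² → Carrier} → (∀ x → Nonzero x → F x ≈ G x) → Σℙ¹ F ≈ Σℙ¹ G
  Σℙ¹-cong F≈G = +-cong (F≈G (true , false) _) (+-cong (F≈G (false , true) _) (F≈G (true , true) _))

  Σℙ¹-evB : ∀ {r} (f : V r) → Σℙ¹ (evB f) ≈ f zero + (f (fromℕ r) + sum f)
  Σℙ¹-evB f = +-cong (ev-[1:0] f) (+-cong (ev-[0:1] f) (ev-[1:1] f))

  combine : F₂² → Bool → Bool → Bool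
  combine (false , false) u v = false
  combine (true  , false) u v = u
  combine (false , true)  u v = v
  combine (true  , true)  u v = u xor v

  -- The row vector x times the matrix g.
  _⋆_ : GL2F2 → F₂² → F₂²
  mat a b c d _ ⋆ x = combine x a c , combine x b d

  record Permutesℙ¹ (σ : F₂² → F₂²) : Set (c ⊔ ℓ) where
    field
      nonzero       : ∀ x → Nonzero x → Nonzero (σ x)
      Σℙ¹-invariant : ∀ F → Σℙ¹ (F ∘ σ) ≈ Σℙ¹ F

  permutesℙ¹ : ∀ {σ} → Nonzero (σ (true , false)) → Nonzero (σ (false , true)) →
               Nonzero (σ (true , true)) → (∀ F → Σℙ¹ (F ∘ σ) ≈ Σℙ¹ F) → Permutesℙ¹ σ
  permutesℙ¹ {σ} nz₁₀ nz₀₁ nz₁₁ invariant = record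
    { nonzero       = ℙ¹-elim (Nonzero ∘ σ) nz₁₀ nz₀₁ nz₁₁
    ; Σℙ¹-invariant = invariant
    }

  ⋆-permutesℙ¹ : ∀ g → Permutesℙ¹ (g ⋆_)
  ⋆-permutesℙ¹ (mat false false _     _     ())
  ⋆-permutesℙ¹ (mat true  false false false ())
  ⋆-permutesℙ¹ (mat true  false true  false ())
  ⋆-permutesℙ¹ (mat false true  false false ())
  ⋆-permutesℙ¹ (mat false true  false true  ())
  ⋆-permutesℙ¹ (mat true  true  false false ())
  ⋆-permutesℙ¹ (mat true  true  true  true  ())
  ⋆-permutesℙ¹ (mat true  false false true  _) = permutesℙ¹ _ _ _ λ F → refl
  ⋆-permutesℙ¹ (mat false true  true  false _) = permutesℙ¹ _ _ _ λ F → x∙yz≈y∙xz _ _ _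
  ⋆-permutesℙ¹ (mat true  true  false true  _) = permutesℙ¹ _ _ _ λ F → x∙yz≈z∙yx _ _ _
  ⋆-permutesℙ¹ (mat true  false true  true  _) = permutesℙ¹ _ _ _ λ F → x∙yz≈x∙zy _ _ _
  ⋆-permutesℙ¹ (mat false true  true  true  _) = permutesℙ¹ _ _ _ λ F → x∙yz≈z∙xy _ _ _
  ⋆-permutesℙ¹ (mat true  true  true  false _) = permutesℙ¹ _ _ _ λ F → x∙yz≈y∙zx _ _ _

  -- Characteristic two

  module Characteristic2 (char2 : 1# + 1# ≈ 0#) where

    x+x≈0 : ∀ x → x + x ≈ 0#
    x+x≈0 x = begin
      x + x             ≈⟨ +-cong (*-identityʳ x) (*-identityʳ x) ⟨
      x * 1# + x * 1#   ≈⟨ distribˡ x 1# 1# ⟨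
      x * (1# + 1#)     ≈⟨ *-congˡ char2 ⟩
      x * 0#            ≈⟨ zeroʳ x ⟩
      0#                ∎

    ⟦⟧-xor : ∀ u v → ⟦ u xor v ⟧ ≈ ⟦ u ⟧ + ⟦ v ⟧
    ⟦⟧-xor true  true  = sym char2
    ⟦⟧-xor true  false = sym (+-identityʳ 1#)
    ⟦⟧-xor false v     = sym (+-identityˡ ⟦ v ⟧)

    ⟦combine⟧ : ∀ x u v → ⟦ combine x u v ⟧ ≈ ⟦ u ⟧ * ⟦ proj₁ x ⟧ + ⟦ v ⟧ * ⟦ proj₂ x ⟧
    ⟦combine⟧ (false , false) u v = sym (trans (+-cong (zeroʳ ⟦ u ⟧) (zeroʳ ⟦ v ⟧)) (+-identityʳ 0#))
    ⟦combine⟧ (true  , false) u v =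
      sym (trans (+-cong (*-identityʳ ⟦ u ⟧) (zeroʳ ⟦ v ⟧)) (+-identityʳ ⟦ u ⟧))
    ⟦combine⟧ (false , true)  u v =
      sym (trans (+-cong (zeroʳ ⟦ u ⟧) (*-identityʳ ⟦ v ⟧)) (+-identityˡ ⟦ v ⟧))
    ⟦combine⟧ (true  , true)  u v =
      trans (⟦⟧-xor u v) (sym (+-cong (*-identityʳ ⟦ u ⟧) (*-identityʳ ⟦ v ⟧)))

    evB-act : ∀ {r} g (f : V r) x → evB (act g f) x ≈ evB f (g ⋆ x)
    evB-act (mat a b c d det) f x@(p , q) =
      trans (ev-act a b c d det f ⟦ p ⟧ ⟦ q ⟧) (sym (ev-cong₂ f (⟦combine⟧ x a c) (⟦combine⟧ x b d)))

    act-≐ : ∀ {m n} g {f : V m} {f′ : V n} → f ≐ f′ → act g f ≐ act g f′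
    act-≐ g {f} {f′} (agree f≐f′) = agree λ x nz → begin
      evB (act g f) x    ≈⟨ evB-act g f x ⟩
      evB f (g ⋆ x)      ≈⟨ f≐f′ (g ⋆ x) (Permutesℙ¹.nonzero (⋆-permutesℙ¹ g) x nz) ⟩
      evB f′ (g ⋆ x)     ≈⟨ evB-act g f′ x ⟨
      evB (act g f′) x   ∎

    π≈Σℙ¹ : ∀ {r} (f : V (suc r)) w → π (suc r) f w ≈ Σℙ¹ (evB f)
    π≈Σℙ¹ {r} f w = begin
      π (suc r) f w                               ≈⟨ cancel (f zero) fₗ (π (suc r) f w) ⟨
      f zero + (fₗ + (f zero + (π (suc r) f w + fₗ))) ≈⟨ +-congˡ (+-congˡ (π-ends f w (s≤s z≤n))) ⟩
      f zero + (fₗ + sum f)                       ≈⟨ Σℙ¹-evB f ⟨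
      Σℙ¹ (evB f)                                 ∎
      where
      fₗ : Carrier
      fₗ = f (fromℕ (suc r))

      cancel : ∀ a b x → a + (b + (a + (x + b))) ≈ x
      cancel a b x = begin
        a + (b + (a + (x + b)))
          ≈⟨ solve 3 (λ a b x → (a :+ (b :+ (a :+ (x :+ b)))) := ((a :+ a) :+ (x :+ (b :+ b)))) refl a b x ⟩
        (a + a) + (x + (b + b))   ≈⟨ +-cong (x+x≈0 a) (+-congˡ (x+x≈0 b)) ⟩
        0# + (x + 0#)             ≈⟨ trans (+-identityˡ _) (+-identityʳ x) ⟩
        x                         ∎

    Σℙ¹-V₀ : ∀ (w : V 0) → Σℙ¹ (evB w) ≈ w zero
    Σℙ¹-V₀ w = begin
      Σℙ¹ (evB w)                        ≈⟨ Σℙ¹-evB w ⟩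
      w zero + (w zero + (w zero + 0#))  ≈⟨ +-congˡ (trans (+-congˡ (+-identityʳ _)) (x+x≈0 _)) ⟩
      w zero + 0#                        ≈⟨ +-identityʳ _ ⟩
      w zero                             ∎

    Σℙ¹-V₁ : ∀ (u : V 1) → Σℙ¹ (evB u) ≈ 0#
    Σℙ¹-V₁ u = begin
      Σℙ¹ (evB u)                    ≈⟨ Σℙ¹-evB u ⟩
      u₀ + (u₁ + (u₀ + (u₁ + 0#)))   ≈⟨ +-congˡ (+-congˡ (+-congˡ (+-identityʳ u₁))) ⟩
      u₀ + (u₁ + (u₀ + u₁))          ≈⟨ solve 2 (λ a b → (a :+ (b :+ (a :+ b))) := ((a :+ a) :+ (b :+ b)))
                                                refl u₀ u₁ ⟩
      (u₀ + u₀) + (u₁ + u₁)          ≈⟨ trans (+-cong (x+x≈0 u₀) (x+x≈0 u₁)) (+-identityˡ 0#) ⟩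
      0#                             ∎
      where
      u₀ u₁ : Carrier
      u₀ = u zero
      u₁ = u (suc zero)

    π-≐ : ∀ {r} {f f′ : V (suc r)} → f ≐ f′ → π (suc r) f ≋ π (suc r) f′
    π-≐ {f = f} {f′} f≐f′ w = trans (π≈Σℙ¹ f w) (trans (Σℙ¹-cong (_≐_.at f≐f′)) (sym (π≈Σℙ¹ f′ w)))

    π-linear : ∀ {r} x (f f′ : V (suc r)) →
               π (suc r) ((x ⊙ f) ⊕ f′) ≋ ((x ⊙ π (suc r) f) ⊕ π (suc r) f′)
    π-linear {r} x f f′ w = begin
      π (suc r) ((x ⊙ f) ⊕ f′) w           ≈⟨ π≈Σℙ¹ ((x ⊙ f) ⊕ f′) w ⟩
      Σℙ¹ (evB ((x ⊙ f) ⊕ f′))             ≈⟨ Σℙ¹-cong (λ { (p , q) _ → ev-linear x f f′ ⟦ p ⟧ ⟦ q ⟧ }) ⟩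
      Σℙ¹ (λ y → x * evB f y + evB f′ y)
        ≈⟨ solve 7 (λ x a b c a′ b′ c′ → (((x :* a) :+ a′) :+ (((x :* b) :+ b′) :+ ((x :* c) :+ c′)))
                                         := ((x :* (a :+ (b :+ c))) :+ (a′ :+ (b′ :+ c′))))
                   refl x _ _ _ _ _ _ ⟩
      x * Σℙ¹ (evB f) + Σℙ¹ (evB f′)       ≈⟨ +-cong (*-congˡ (π≈Σℙ¹ f w)) (π≈Σℙ¹ f′ w) ⟨
      x * π (suc r) f w + π (suc r) f′ w   ∎

    π-equivariant : ∀ {r} g (f : V (suc r)) → π (suc r) (act g f) ≋ act g (π (suc r) f)
    π-equivariant {r} g f w = begin
      π (suc r) (act g f) w   ≈⟨ π≈Σℙ¹ (act g f) w ⟩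
      Σℙ¹ (evB (act g f))     ≈⟨ Σℙ¹-cong (λ x _ → evB-act g f x) ⟩
      Σℙ¹ (evB f ∘ (g ⋆_))    ≈⟨ Permutesℙ¹.Σℙ¹-invariant (⋆-permutesℙ¹ g) (evB f) ⟩
      Σℙ¹ (evB f)             ≈⟨ π≈Σℙ¹ f w ⟨
      π (suc r) f w           ≈⟨ act-V₀ g (π (suc r) f) w ⟨
      act g (π (suc r) f) w   ∎

    π∘ι≋𝟘 : ∀ r (u : V 1) → π (suc r) (ι (suc r) u) ≋ 𝟘
    π∘ι≋𝟘 r u w = trans (π≈Σℙ¹ (ι (suc r) u) w) (trans (Σℙ¹-cong (_≐_.at (ι≐ r u))) (Σℙ¹-V₁ u))

    -- w (Xʳ + Xʳ⁻¹Y + Yʳ), which takes the value w at each point of ℙ¹(F₂).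
    section : ∀ q → V 0 → V (2 ℕ.+ q)
    section q w = ι (2 ℕ.+ q) (lin (w zero) (w zero)) ⊕ λ k → δ 1 (toℕ k) (w zero)

    section≐ : ∀ q (w : V 0) → section q w ≐ w
    section≐ q w = ≐-intro {f = section q w} {g = w}
      (+-identityʳ w₀)
      (trans (+-congʳ (reflexive (ι-last (suc q) (lin w₀ w₀)))) (+-identityʳ w₀))
      (begin
        sum (section q w)
          ≈⟨ ∑-distrib-+ (ι (2 ℕ.+ q) (lin w₀ w₀)) (λ k → δ 1 (toℕ k) w₀) ⟩
        sum (ι (2 ℕ.+ q) (lin w₀ w₀)) + ∑[ k < 3 ℕ.+ q ] δ 1 (toℕ k) w₀
          ≈⟨ +-cong (ι-sum (suc q) (lin w₀ w₀)) middle ⟩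
        (w₀ + (w₀ + 0#)) + w₀
          ≈⟨ +-congʳ (trans (+-congˡ (+-identityʳ w₀)) (x+x≈0 w₀)) ⟩
        0# + w₀
          ≈⟨ trans (+-identityˡ w₀) (sym (+-identityʳ w₀)) ⟩
        sum w ∎)
      where
      w₀ : Carrier
      w₀ = w zero

      middle : ∑[ k < 3 ℕ.+ q ] δ 1 (toℕ k) w₀ ≈ w₀
      middle = trans (sum-cong-≋ {3 ℕ.+ q} λ k → sym (*-identityʳ (δ 1 (toℕ k) w₀)))
                     (trans (sum-δ {3 ℕ.+ q} 1 (s≤s (s≤s z≤n)) w₀ (λ _ → 1#)) (*-identityʳ w₀))

    π∘section≋id : ∀ q (w : V 0) → π (2 ℕ.+ q) (section q w) ≋ w
    π∘section≋id q w zero =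
      trans (π≈Σℙ¹ (section q w) zero) (trans (Σℙ¹-cong (_≐_.at (section≐ q w))) (Σℙ¹-V₀ w))

    splitSES : ∀ q → SplitSES (2 ℕ.+ q)
    splitSES q = record
      { ι-resp       = λ u v u≋v → to∼ (≐-trans (ι≐′ u) (≐-trans (≋⇒≐ u≋v) (≐-sym (ι≐′ v))))
      ; ι-linear     = λ x u v → to∼ (≐-trans (ι≐′ ((x ⊙ u) ⊕ v)) (≐-sym (linear-≐ x (ι≐′ u) (ι≐′ v))))
      ; ι-equiv      = λ g u → to∼ (≐-trans (ι≐′ (act g u)) (≐-sym (act-≐ g (ι≐′ u))))
      ; π-resp       = λ f f′ f∼f′ → π-≐ (from∼ f∼f′)
      ; π-linear     = π-linear
      ; π-equiv      = π-equivariant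
      ; ι-injective  = λ u v ιu∼ιv → ≐⇒≋ (≐-trans (≐-sym (ι≐′ u)) (≐-trans (from∼ ιu∼ιv) (ι≐′ v)))
      ; π-surjective = λ w → section q w , π∘section≋id q w
      ; im⊆ker       = π∘ι≋𝟘 (suc q)
      ; ker⊆im       = λ f πf≋𝟘 → lin (f zero) (f (fromℕ (2 ℕ.+ q))) , to∼ (π≋𝟘⇒ι≐ f πf≋𝟘)
      ; s            = section q
      ; s-resp       = λ w w′ w≋w′ →
                         to∼ (≐-trans (section≐ q w) (≐-trans (≋⇒≐ w≋w′) (≐-sym (section≐ q w′))))
      ; s-linear     = λ x w w′ → to∼ (≐-trans (section≐ q ((x ⊙ w) ⊕ w′))
                                               (≐-sym (linear-≐ x (section≐ q w) (section≐ q w′))))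
      ; s-equiv      = λ g w → to∼ (≐-trans (section≐ q (act g w)) (≐-sym (act-≐ g (section≐ q w))))
      ; π∘s≋id       = π∘section≋id q
      }
      where
      to∼ : ∀ {f g : V (2 ℕ.+ q)} → f ≐ g → InV⁽¹⁾ (2 ℕ.+ q) (f ⊖ g)
      to∼ = ≐⇒InV⁽¹⁾-⊖ q

      from∼ : ∀ {f g : V (2 ℕ.+ q)} → InV⁽¹⁾ (2 ℕ.+ q) (f ⊖ g) → f ≐ g
      from∼ = InV⁽¹⁾-⊖⇒≐ q

      ι≐′ : ∀ u → ι (2 ℕ.+ q) u ≐ u
      ι≐′ = ι≐ (suc q)

proposition2p3 : {c ℓ : Level} (K : CommutativeRing c ℓ) → IsAlgebraicClosureOfF₂ K →
                 (r : ℕ) → 2 ≤ r → Over.SplitSES K r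
proposition2p3 K closure (suc (suc q)) _ =
  Characteristic2.splitSES K (IsAlgebraicClosureOfF₂.char2 closure) q
proposition2p3 K closure (suc zero) (s≤s ())
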